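{- Let $G=(V,E)$ be an unweighted graph with maximum degree $\Delta\le2$. Then every stable cut $S$ in $G$ satisfies $\varphi(S)\ge\frac12\max_{S'\subseteq V}\varphi(S')$.
   Context: For a cut $S\subseteq V$: $d(v)$ is the degree of $v$ and $d_S(v)$ the number of edges at $v$ with exactly one endpoint in $S$; $S$ is stable if $d_S(v)>(d(v)-1)/2$ for all $v\in V$. $C_{S,G}$ is the number of edges crossing $S$, and $\varphi(S)=\min_{v\in V}C_{S-\{v\},G-\{v\}}$, where $G-\{v\}$ deletes $v$ and its incident edges. -}

module Defs where

open import Data.Nat using (ℕ; zero; suc; _+_; _*_; _≤_; _<_; _⊓_)
open import Data.Bool using (Bool; true; false; _∧_; _xor_; if_then_else_)
open import Data.Fin using (Fin; zero; suc; toℕ; punchIn)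
open import Data.Nat using (_<ᵇ_)
open import Relation.Binary.PropositionalEquality using (_≡_)

sumFin : {n : ℕ} → (Fin n → ℕ) → ℕ
sumFin {zero} f = 0
sumFin {suc n} f = f zero + sumFin (λ i → f (suc i))

minFin : {n : ℕ} → (Fin (suc n) → ℕ) → ℕ
minFin {zero} f = f zero
minFin {suc n} f = f zero ⊓ minFin (λ i → f (suc i))

indicator : Bool → ℕ
indicator b = if b then 1 else 0

record Graph (n : ℕ) : Set where
  field
    adj   : Fin n → Fin n → Bool
    sym   : ∀ u v → adj u v ≡ adj v u
    irrefl : ∀ v → adj v v ≡ false
open Graph public

Cut : ℕ → Set
Cut n = Fin n → Bool

deg : {n : ℕ} → Graph n → Fin n → ℕ
deg G v = sumFin (λ u → indicator (adj G v u))

degS : {n : ℕ} → Graph n → Cut n → Fin n → ℕ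
degS G S v = sumFin (λ u → indicator (adj G v u ∧ (S v xor S u)))

MaxDegreeAtMost : {n : ℕ} → Graph n → ℕ → Set
MaxDegreeAtMost G k = ∀ v → deg G v ≤ k

-- S stable iff d_S(v) > (d(v) - 1)/2 for all v, i.e. d(v) - 1 < 2 d_S(v),
-- i.e. (over ℕ, avoiding truncated subtraction) d(v) < 2 d_S(v) + 1
Stable : {n : ℕ} → Graph n → Cut n → Set
Stable G S = ∀ v → deg G v < 2 * degS G S v + 1

crossing : {n : ℕ} → Graph n → Cut n → ℕ
crossing G S =
  sumFin (λ a → sumFin (λ b →
    indicator ((toℕ a <ᵇ toℕ b) ∧ (adj G a b ∧ (S a xor S b)))))

deleteVertex : {m : ℕ} → Graph (suc m) → Fin (suc m) → Graph m
deleteVertex G v = record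
  { adj = λ a b → adj G (punchIn v a) (punchIn v b)
  ; sym = λ a b → sym G (punchIn v a) (punchIn v b)
  ; irrefl = λ a → irrefl G (punchIn v a)
  }

deleteFromCut : {m : ℕ} → Cut (suc m) → Fin (suc m) → Cut m
deleteFromCut S v a = S (punchIn v a)

φ : {m : ℕ} → Graph (suc m) → Cut (suc m) → ℕ
φ G S = minFin (λ v → crossing (deleteVertex G v) (deleteFromCut S v))

-- Write C(S) for the number of edges crossing S and M(S) = max_v d_S(v). Deleting v removes exactly
-- d_S(v) crossing edges, so φ(S) = C(S) − M(S), and Δ ≤ 2 gives M ≤ 2. Stability gives
-- d_S′(v) ≤ d(v) ≤ 2 d_S(v) for every v, hence C(S′) ≤ 2 C(S) by the handshake identity
-- Σ_v d_S(v) = 2 C(S); this settles the case 2 M(S) ≤ M(S′). If M(S′) = 1 then d_S′ ≤ d_S pointwise,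
-- and leaving out a vertex where d_S is maximal gives 2 C(S′) + M(S) ≤ 1 + 2 C(S). In the remaining
-- case M(S) = M(S′) = 2 one more unit is won by parity: sum d_S′ ≤ 2 d_S over each side of S′
-- (on either side the sum of d_S′ is C(S′)), with a slack of 2 at a vertex where d_S = 2.
module Submission where

open import Defs renaming (sym to adj-sym)
open import Data.Nat using (ℕ; zero; suc; _+_; _*_; _≤_; _<_; _⊓_; _⊔_; _<ᵇ_; z≤n; s≤s)
open import Data.Nat.Properties
open import Data.Nat.Tactic.RingSolver using (solve-∀)
open import Data.Bool using (Bool; true; false; _∧_; _xor_; not)
open import Data.Bool.Properties using (xor-comm)
open import Data.Empty using (⊥-elim)
open import Data.Fin using (Fin; zero; suc; toℕ; punchIn)
open import Data.Fin.Properties using (toℕ-injective)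
open import Data.Product using (Σ; _,_; proj₁; proj₂)
open import Data.Sum using (inj₁; inj₂; [_,_]′)
open import Function using (flip; _∘_)
open import Relation.Binary.PropositionalEquality
open import Relation.Nullary.Negation using (contradiction)
open import Relation.Nullary.Reflects using (ofʸ; ofⁿ)
open import Algebra.Properties.Semiring.Sum +-*-semiring
  using (sum; sum-cong-≗; ∑-distrib-+; ∑-comm; sum-remove; *-distribˡ-sum; sum-replicate-zero)

sumFin≡sum : ∀ {n} (f : Fin n → ℕ) → sumFin f ≡ sum f
sumFin≡sum {zero} f = refl
sumFin≡sum {suc n} f = cong (f zero +_) (sumFin≡sum (λ i → f (suc i)))

sumFin-cong : ∀ {n} {f g : Fin n → ℕ} → (∀ i → f i ≡ g i) → sumFin f ≡ sumFin g
sumFin-cong {f = f} {g} f≗g rewrite sumFin≡sum f | sumFin≡sum g = sum-cong-≗ f≗g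

sumFin-distrib-+ : ∀ {n} (f g : Fin n → ℕ) → sumFin (λ i → f i + g i) ≡ sumFin f + sumFin g
sumFin-distrib-+ f g
  rewrite sumFin≡sum (λ i → f i + g i) | sumFin≡sum f | sumFin≡sum g = ∑-distrib-+ f g

sumFin-comm : ∀ {m n} (f : Fin m → Fin n → ℕ) →
              sumFin (λ i → sumFin (f i)) ≡ sumFin (λ j → sumFin (λ i → f i j))
sumFin-comm f = trans (sumFin² f) (trans (∑-comm f) (sym (sumFin² (flip f))))
  where
  sumFin² : ∀ {m n} (f : Fin m → Fin n → ℕ) → sumFin (λ i → sumFin (f i)) ≡ sum (λ i → sum (f i))
  sumFin² f = trans (sumFin≡sum (λ i → sumFin (f i))) (sum-cong-≗ (λ i → sumFin≡sum (f i)))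

sumFin-remove : ∀ {n} (f : Fin (suc n) → ℕ) v → sumFin f ≡ f v + sumFin (λ i → f (punchIn v i))
sumFin-remove f v rewrite sumFin≡sum f | sumFin≡sum (λ i → f (punchIn v i)) = sum-remove f

sumFin-distribˡ-* : ∀ {n} k (f : Fin n → ℕ) → sumFin (λ i → k * f i) ≡ k * sumFin f
sumFin-distribˡ-* k f
  rewrite sumFin≡sum (λ i → k * f i) | sumFin≡sum f = sym (*-distribˡ-sum k f)

sumFin-zero : ∀ {n} → sumFin {n} (λ _ → 0) ≡ 0
sumFin-zero {n} = trans (sumFin≡sum {n} (λ _ → 0)) (sum-replicate-zero n)

sumFin-mono : ∀ {n} {f g : Fin n → ℕ} → (∀ i → f i ≤ g i) → sumFin f ≤ sumFin g
sumFin-mono {zero} f≤g = z≤n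
sumFin-mono {suc n} f≤g = +-mono-≤ (f≤g zero) (sumFin-mono (λ i → f≤g (suc i)))

sumFin-mono-gap : ∀ {n k} {f g : Fin (suc n) → ℕ} v → (∀ i → f i ≤ g i) → f v + k ≤ g v →
                  sumFin f + k ≤ sumFin g
sumFin-mono-gap {k = k} {f} {g} v f≤g gap = begin
  sumFin f + k                                        ≡⟨ cong (_+ k) (sumFin-remove f v) ⟩
  f v + sumFin (λ i → f (punchIn v i)) + k            ≡⟨ +-assoc (f v) _ k ⟩
  f v + (sumFin (λ i → f (punchIn v i)) + k)          ≡⟨ cong (f v +_) (+-comm _ k) ⟩
  f v + (k + sumFin (λ i → f (punchIn v i)))          ≡⟨ +-assoc (f v) k _ ⟨
  f v + k + sumFin (λ i → f (punchIn v i))            ≤⟨ +-mono-≤ gap (sumFin-mono (λ i → f≤g (punchIn v i))) ⟩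
  g v + sumFin (λ i → g (punchIn v i))                ≡⟨ sumFin-remove g v ⟨
  sumFin g                                            ∎
  where open ≤-Reasoning

+≡+⇒≤ : ∀ {a b c d} → a + b ≡ c + d → b ≤ d → c ≤ a
+≡+⇒≤ {a} {b} {c} {d} a+b≡c+d b≤d =
  +-cancelʳ-≤ d c a (≤-trans (≤-reflexive (sym a+b≡c+d)) (+-monoʳ-≤ a b≤d))

m≤1⇒m≤2*n⇒m≤n : ∀ {m n} → m ≤ 1 → m ≤ 2 * n → m ≤ n
m≤1⇒m≤2*n⇒m≤n z≤n _ = z≤n
m≤1⇒m≤2*n⇒m≤n {n = zero} (s≤s z≤n) ()
m≤1⇒m≤2*n⇒m≤n {n = suc n} (s≤s z≤n) _ = s≤s z≤n

-- The hypotheses give c + 1 ≤ 2k; equality would force c ≡ 2q and make 2k odd.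
parity-gap : ∀ {c p q k} → c + 2 ≤ 2 * p → c ≤ 2 * q → p + q ≡ 2 * k → c + 2 ≤ 2 * k
parity-gap {c} {p} {q} {k} c+2≤2p c≤2q p+q≡2k =
  [ subst (_≤ 2 * k) (sym (+-suc c 1)) , (λ c+1≡2k → ⊥-elim (even≢odd k q (2k≡1+2q c+1≡2k))) ]′
  (m≤n⇒m<n∨m≡n c+1≤2k)
  where
  open ≤-Reasoning
  double : ∀ c → 2 * (c + 1) ≡ c + 2 + c
  double = solve-∀
  sum≤ : c + 2 + c ≤ 2 * (2 * k)
  sum≤ = begin
    c + 2 + c        ≤⟨ +-mono-≤ c+2≤2p c≤2q ⟩
    2 * p + 2 * q    ≡⟨ *-distribˡ-+ 2 p q ⟨
    2 * (p + q)      ≡⟨ cong (2 *_) p+q≡2k ⟩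
    2 * (2 * k)      ∎
  c+1≤2k : c + 1 ≤ 2 * k
  c+1≤2k = *-cancelˡ-≤ 2 (≤-trans (≤-reflexive (double c)) sum≤)
  2k≡1+2q : c + 1 ≡ 2 * k → 2 * k ≡ suc (2 * q)
  2k≡1+2q c+1≡2k = begin-equality
    2 * k     ≡⟨ c+1≡2k ⟨
    c + 1     ≡⟨ +-comm c 1 ⟩
    suc c     ≡⟨ cong suc (≤-antisym c≤2q 2q≤c) ⟩
    suc (2 * q) ∎
    where
    2q≤c : 2 * q ≤ c
    2q≤c = +-cancelˡ-≤ (c + 2) (2 * q) c (begin
      c + 2 + 2 * q  ≤⟨ +-monoˡ-≤ (2 * q) c+2≤2p ⟩
      2 * p + 2 * q  ≡⟨ *-distribˡ-+ 2 p q ⟨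
      2 * (p + q)    ≡⟨ cong (2 *_) (trans p+q≡2k (sym c+1≡2k)) ⟩
      2 * (c + 1)    ≡⟨ double c ⟩
      c + 2 + c      ∎)

2[m+1]+k≤1+2[n+k]⇒m≤n : ∀ {m n k} → k ≤ 2 → 2 * (m + 1) + k ≤ 1 + 2 * (n + k) → m ≤ n
2[m+1]+k≤1+2[n+k]⇒m≤n {m} {n} {k} k≤2 h = m<1+n⇒m≤n (*-cancelˡ-< 2 m (suc n) (begin
  suc (2 * m)   ≤⟨ +-cancelʳ-≤ (suc k) (suc (2 * m)) (2 * n + k) (subst₂ _≤_ (lhs m k) (rhs n k) h) ⟩
  2 * n + k     ≤⟨ +-monoʳ-≤ (2 * n) k≤2 ⟩
  2 * n + 2     ≡⟨ *-distribˡ-+ 2 n 1 ⟨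
  2 * (n + 1)   ≡⟨ cong (2 *_) (+-comm n 1) ⟩
  2 * suc n     ∎))
  where
  open ≤-Reasoning
  lhs : ∀ m k → 2 * (m + 1) + k ≡ suc (2 * m) + suc k
  lhs = solve-∀
  rhs : ∀ n k → 1 + 2 * (n + k) ≡ 2 * n + k + suc k
  rhs = solve-∀

maxFin : ∀ {n} → (Fin (suc n) → ℕ) → ℕ
maxFin {zero} f = f zero
maxFin {suc n} f = f zero ⊔ maxFin (λ i → f (suc i))

≤-maxFin : ∀ {n} (f : Fin (suc n) → ℕ) i → f i ≤ maxFin f
≤-maxFin {zero} f zero = ≤-refl
≤-maxFin {suc n} f zero = m≤m⊔n (f zero) _
≤-maxFin {suc n} f (suc i) = m≤n⇒m≤o⊔n (f zero) (≤-maxFin (λ i → f (suc i)) i)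

maxFin-lub : ∀ {n k} (f : Fin (suc n) → ℕ) → (∀ i → f i ≤ k) → maxFin f ≤ k
maxFin-lub {zero} f f≤k = f≤k zero
maxFin-lub {suc n} f f≤k = ⊔-lub (f≤k zero) (maxFin-lub (λ i → f (suc i)) (λ i → f≤k (suc i)))

maxFin-attained : ∀ {n} (f : Fin (suc n) → ℕ) → Σ (Fin (suc n)) (λ i → maxFin f ≡ f i)
maxFin-attained {zero} f = zero , refl
maxFin-attained {suc n} f with ⊔-sel (f zero) (maxFin (λ i → f (suc i)))
... | inj₁ max≡f₀ = zero , max≡f₀
... | inj₂ max≡rest = let (i , e) = maxFin-attained (λ i → f (suc i)) in suc i , trans max≡rest e

minFin+maxFin≡ : ∀ {n c} {f h : Fin (suc n) → ℕ} → (∀ i → f i + h i ≡ c) → minFin f + maxFin h ≡ c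
minFin+maxFin≡ {zero} f+h≡c = f+h≡c zero
minFin+maxFin≡ {suc n} {c} {f} {h} f+h≡c = [ rest-selected , head-selected ]′ (≤-total (h zero) H)
  where
  open ≡-Reasoning
  F = minFin (λ i → f (suc i))
  H = maxFin (λ i → h (suc i))
  IH : F + H ≡ c
  IH = minFin+maxFin≡ (λ i → f+h≡c (suc i))
  rest-selected : h zero ≤ H → (f zero ⊓ F) + (h zero ⊔ H) ≡ c
  rest-selected h₀≤H = begin
    (f zero ⊓ F) + (h zero ⊔ H)
      ≡⟨ cong₂ _+_ (m≥n⇒m⊓n≡n (+≡+⇒≤ (trans (f+h≡c zero) (sym IH)) h₀≤H)) (m≤n⇒m⊔n≡n h₀≤H) ⟩
    F + H
      ≡⟨ IH ⟩
    c ∎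
  head-selected : H ≤ h zero → (f zero ⊓ F) + (h zero ⊔ H) ≡ c
  head-selected H≤h₀ = begin
    (f zero ⊓ F) + (h zero ⊔ H)
      ≡⟨ cong₂ _+_ (m≤n⇒m⊓n≡m (+≡+⇒≤ (trans IH (sym (f+h≡c zero))) H≤h₀)) (m≥n⇒m⊔n≡m H≤h₀) ⟩
    f zero + h zero
      ≡⟨ f+h≡c zero ⟩
    c ∎

module _ {n} (G : Graph n) (S : Cut n) where

  crosses : Fin n → Fin n → ℕ
  crosses a b = indicator (adj G a b ∧ (S a xor S b))

  crosses< : Fin n → Fin n → ℕ
  crosses< a b = indicator ((toℕ a <ᵇ toℕ b) ∧ (adj G a b ∧ (S a xor S b)))

  crosses-sym : ∀ a b → crosses a b ≡ crosses b a
  crosses-sym a b rewrite adj-sym G a b | xor-comm (S a) (S b) = refl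

  crosses-self : ∀ a → crosses a a ≡ 0
  crosses-self a rewrite irrefl G a = refl

  crosses≡crosses<+crosses< : ∀ a b → crosses a b ≡ crosses< a b + crosses< b a
  crosses≡crosses<+crosses< a b rewrite adj-sym G b a | xor-comm (S b) (S a)
    with toℕ a <ᵇ toℕ b | <ᵇ-reflects-< (toℕ a) (toℕ b) | toℕ b <ᵇ toℕ a | <ᵇ-reflects-< (toℕ b) (toℕ a)
  ... | true  | ofʸ a<b | true  | ofʸ b<a = ⊥-elim (<-asym a<b b<a)
  ... | true  | _       | false | _       = sym (+-identityʳ _)
  ... | false | _       | true  | _       = refl
  ... | false | ofⁿ a≮b | false | ofⁿ b≮a =
    trans (cong (crosses a) (sym a≡b)) (crosses-self a)
    where
    a≡b : a ≡ b
    a≡b = toℕ-injective (≤-antisym (≮⇒≥ b≮a) (≮⇒≥ a≮b))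

  sumFin-degS : sumFin (degS G S) ≡ 2 * crossing G S
  sumFin-degS = begin
    sumFin (λ a → sumFin (crosses a))
      ≡⟨ sumFin-cong (λ a → sumFin-cong (crosses≡crosses<+crosses< a)) ⟩
    sumFin (λ a → sumFin (λ b → crosses< a b + crosses< b a))
      ≡⟨ sumFin-cong (λ a → sumFin-distrib-+ (crosses< a) (flip crosses< a)) ⟩
    sumFin (λ a → sumFin (crosses< a) + sumFin (flip crosses< a))
      ≡⟨ sumFin-distrib-+ (λ a → sumFin (crosses< a)) (λ a → sumFin (flip crosses< a)) ⟩
    crossing G S + sumFin (λ a → sumFin (flip crosses< a))
      ≡⟨ cong (crossing G S +_) (sumFin-comm (flip crosses<)) ⟩
    crossing G S + crossing G S
      ≡⟨ cong (crossing G S +_) (sym (+-identityʳ _)) ⟩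
    2 * crossing G S
      ∎
    where open ≡-Reasoning

indicator-∧-≤ : ∀ x y → indicator (x ∧ y) ≤ indicator x
indicator-∧-≤ true  true  = ≤-refl
indicator-∧-≤ true  false = z≤n
indicator-∧-≤ false y = z≤n

degS≤deg : ∀ {n} (G : Graph n) T v → degS G T v ≤ deg G v
degS≤deg G T v = sumFin-mono (λ u → indicator-∧-≤ (adj G v u) (T v xor T u))

degS≤0⇒crossing≤0 : ∀ {n} (G : Graph n) S → (∀ v → degS G S v ≤ 0) → crossing G S ≤ 0
degS≤0⇒crossing≤0 {n} G S σ≤0 = *-cancelˡ-≤ 2 (begin
  2 * crossing G S      ≡⟨ sumFin-degS G S ⟨
  sumFin (degS G S)     ≤⟨ sumFin-mono σ≤0 ⟩
  sumFin {n} (λ _ → 0)  ≡⟨ sumFin-zero {n} ⟩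
  0                     ∎)
  where open ≤-Reasoning

-- onSide T b a is 1 exactly when T a ≡ b.
onSide : ∀ {n} → Cut n → Bool → Fin n → ℕ
onSide T b a = indicator (not b xor T a)

onSide+onSide-not : ∀ {n} (T : Cut n) b a → onSide T b a + onSide T (not b) a ≡ 1
onSide+onSide-not T b a with b | T a
... | true  | true  = refl
... | true  | false = refl
... | false | true  = refl
... | false | false = refl

onSide-self : ∀ {n} (T : Cut n) a → onSide T (T a) a ≡ 1
onSide-self T a with T a
... | true  = refl
... | false = refl

-- A crossing edge has exactly one endpoint on each side.
onSide-crossing-endpoints : ∀ b x y e → let X = indicator (e ∧ (x xor y)) in
  indicator (not b xor x) * X + indicator (not b xor y) * X ≡ X
onSide-crossing-endpoints b x y false
  rewrite *-zeroʳ (indicator (not b xor x)) | *-zeroʳ (indicator (not b xor y)) = refl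
onSide-crossing-endpoints true  true  true  true = refl
onSide-crossing-endpoints true  true  false true = refl
onSide-crossing-endpoints true  false true  true = refl
onSide-crossing-endpoints true  false false true = refl
onSide-crossing-endpoints false true  true  true = refl
onSide-crossing-endpoints false true  false true = refl
onSide-crossing-endpoints false false true  true = refl
onSide-crossing-endpoints false false false true = refl

sumFin-onSide-degS : ∀ {n} (G : Graph n) S b → sumFin (λ a → onSide S b a * degS G S a) ≡ crossing G S
sumFin-onSide-degS {n} G S b = *-cancelˡ-≡ _ _ 2 (begin
  2 * L
    ≡⟨ cong (L +_) (+-identityʳ L) ⟩
  L + L
    ≡⟨ cong₂ _+_ L≡ΣΣtail L≡ΣΣhead ⟩
  sumFin (λ a → sumFin (tail a)) + sumFin (λ a → sumFin (head a))
    ≡⟨ sumFin-distrib-+ (λ a → sumFin (tail a)) (λ a → sumFin (head a)) ⟨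
  sumFin (λ a → sumFin (tail a) + sumFin (head a))
    ≡⟨ sumFin-cong (λ a → sumFin-distrib-+ (tail a) (head a)) ⟨
  sumFin (λ a → sumFin (λ c → tail a c + head a c))
    ≡⟨ sumFin-cong (λ a → sumFin-cong (λ c → onSide-crossing-endpoints b (S a) (S c) (adj G a c))) ⟩
  sumFin (degS G S)
    ≡⟨ sumFin-degS G S ⟩
  2 * crossing G S
    ∎)
  where
  open ≡-Reasoning
  I = onSide S b
  X = crosses G S
  L = sumFin (λ a → I a * degS G S a)
  tail head : Fin n → Fin n → ℕ
  tail a c = I a * X a c
  head a c = I c * X a c
  L≡ΣΣtail : L ≡ sumFin (λ a → sumFin (tail a))
  L≡ΣΣtail = sumFin-cong (λ a → sym (sumFin-distribˡ-* (I a) (X a)))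
  L≡ΣΣhead : L ≡ sumFin (λ a → sumFin (head a))
  L≡ΣΣhead = begin
    L                                          ≡⟨ L≡ΣΣtail ⟩
    sumFin (λ a → sumFin (tail a))             ≡⟨ sumFin-cong (λ a → sumFin-cong (λ c → cong (I a *_) (crosses-sym G S a c))) ⟩
    sumFin (λ a → sumFin (λ c → I a * X c a))  ≡⟨ sumFin-comm (λ a c → I a * X c a) ⟩
    sumFin (λ a → sumFin (head a))             ∎

sumFin-onSide+onSide-not : ∀ {n} (T : Cut n) b (f : Fin n → ℕ) →
  sumFin (λ a → onSide T b a * f a) + sumFin (λ a → onSide T (not b) a * f a) ≡ sumFin f
sumFin-onSide+onSide-not T b f = begin
  sumFin (λ a → onSide T b a * f a) + sumFin (λ a → onSide T (not b) a * f a)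
    ≡⟨ sumFin-distrib-+ (λ a → onSide T b a * f a) (λ a → onSide T (not b) a * f a) ⟨
  sumFin (λ a → onSide T b a * f a + onSide T (not b) a * f a)
    ≡⟨ sumFin-cong (λ a → *-distribʳ-+ (f a) (onSide T b a) (onSide T (not b) a)) ⟨
  sumFin (λ a → (onSide T b a + onSide T (not b) a) * f a)
    ≡⟨ sumFin-cong (λ a → trans (cong (_* f a) (onSide+onSide-not T b a)) (*-identityˡ (f a))) ⟩
  sumFin f
    ∎
  where open ≡-Reasoning

module _ {m} (G : Graph (suc m)) (S : Cut (suc m)) (v : Fin (suc m)) where

  private
    G-v = deleteVertex G v
    S-v = deleteFromCut S v

  degS-punchIn : ∀ a → degS G S (punchIn v a) ≡ crosses G S (punchIn v a) v + degS G-v S-v a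
  degS-punchIn a = sumFin-remove (crosses G S (punchIn v a)) v

  degS≡sumFin-crosses-punchIn : degS G S v ≡ sumFin (λ a → crosses G S (punchIn v a) v)
  degS≡sumFin-crosses-punchIn = begin
    sumFin (crosses G S v)
      ≡⟨ sumFin-cong (crosses-sym G S v) ⟩
    sumFin (λ u → crosses G S u v)
      ≡⟨ sumFin-remove (λ u → crosses G S u v) v ⟩
    crosses G S v v + column
      ≡⟨ cong (_+ column) (crosses-self G S v) ⟩
    column
      ∎
    where
    open ≡-Reasoning
    column = sumFin (λ a → crosses G S (punchIn v a) v)

  -- Compared through degree sums, which do not see the vertex order that crossing counts with.
  crossing-deleteVertex : crossing G-v S-v + degS G S v ≡ crossing G S
  crossing-deleteVertex = *-cancelˡ-≡ _ _ 2 (begin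
    2 * (C′ + d)
      ≡⟨ rearrange C′ d ⟩
    d + (d + 2 * C′)
      ≡⟨ cong₂ (λ x y → d + (x + y)) degS≡sumFin-crosses-punchIn (sym (sumFin-degS G-v S-v)) ⟩
    d + (sumFin (λ a → crosses G S (punchIn v a) v) + sumFin (degS G-v S-v))
      ≡⟨ cong (d +_) (sumFin-distrib-+ (λ a → crosses G S (punchIn v a) v) (degS G-v S-v)) ⟨
    d + sumFin (λ a → crosses G S (punchIn v a) v + degS G-v S-v a)
      ≡⟨ cong (d +_) (sumFin-cong degS-punchIn) ⟨
    d + sumFin (λ a → degS G S (punchIn v a))
      ≡⟨ sumFin-remove (degS G S) v ⟨
    sumFin (degS G S)
      ≡⟨ sumFin-degS G S ⟩
    2 * crossing G S
      ∎)
    where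
    open ≡-Reasoning
    C′ = crossing G-v S-v
    d = degS G S v
    rearrange : ∀ c x → 2 * (c + x) ≡ x + (x + 2 * c)
    rearrange = solve-∀

maxDegS : ∀ {m} → Graph (suc m) → Cut (suc m) → ℕ
maxDegS G S = maxFin (degS G S)

φ+maxDegS≡crossing : ∀ {m} (G : Graph (suc m)) S → φ G S + maxDegS G S ≡ crossing G S
φ+maxDegS≡crossing G S = minFin+maxFin≡ (crossing-deleteVertex G S)

maxDegS≤ : ∀ {m k} (G : Graph (suc m)) T → MaxDegreeAtMost G k → maxDegS G T ≤ k
maxDegS≤ G T Δ≤k = maxFin-lub (degS G T) (λ v → ≤-trans (degS≤deg G T v) (Δ≤k v))

crossing≡φ+maxDegS : ∀ {m} (G : Graph (suc m)) T {k} → maxDegS G T ≡ k → crossing G T ≡ φ G T + k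
crossing≡φ+maxDegS G T maxDegS≡k = trans (sym (φ+maxDegS≡crossing G T)) (cong (φ G T +_) maxDegS≡k)

maxDegS≡0⇒φ≡0 : ∀ {m} (G : Graph (suc m)) T → maxDegS G T ≡ 0 → φ G T ≡ 0
maxDegS≡0⇒φ≡0 G T maxDegS≡0 = n≤0⇒n≡0 (begin
  φ G T        ≤⟨ m≤m+n (φ G T) 0 ⟩
  φ G T + 0    ≡⟨ crossing≡φ+maxDegS G T maxDegS≡0 ⟨
  crossing G T ≤⟨ degS≤0⇒crossing≤0 G T (λ v → subst (degS G T v ≤_) maxDegS≡0 (≤-maxFin (degS G T) v)) ⟩
  0            ∎)
  where open ≤-Reasoning

module _ {n} (G : Graph n) (S : Cut n) (stable : Stable G S) where

  deg≤2*degS : ∀ v → deg G v ≤ 2 * degS G S v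
  deg≤2*degS v = m<1+n⇒m≤n (subst (deg G v <_) (+-comm (2 * degS G S v) 1) (stable v))

  degS≤2*degS : ∀ S′ v → degS G S′ v ≤ 2 * degS G S v
  degS≤2*degS S′ v = ≤-trans (degS≤deg G S′ v) (deg≤2*degS v)

  crossing≤2*crossing : ∀ S′ → crossing G S′ ≤ 2 * crossing G S
  crossing≤2*crossing S′ = *-cancelˡ-≤ 2 (begin
    2 * crossing G S′             ≡⟨ sumFin-degS G S′ ⟨
    sumFin (degS G S′)            ≤⟨ sumFin-mono (degS≤2*degS S′) ⟩
    sumFin (λ v → 2 * degS G S v) ≡⟨ sumFin-distribˡ-* 2 (degS G S) ⟩
    2 * sumFin (degS G S)         ≡⟨ cong (2 *_) (sumFin-degS G S) ⟩
    2 * (2 * crossing G S)        ∎)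
    where open ≤-Reasoning

module _ {m} (G : Graph (suc m)) (S : Cut (suc m)) (stable : Stable G S) where

  2*crossing+degS≤1+2*crossing : ∀ S′ → (∀ v → degS G S′ v ≤ 1) → ∀ w →
                                 2 * crossing G S′ + degS G S w ≤ 1 + 2 * crossing G S
  2*crossing+degS≤1+2*crossing S′ σ′≤1 w = begin
    2 * crossing G S′ + σ w         ≡⟨ cong (_+ σ w) (sumFin-degS G S′) ⟨
    sumFin σ′ + σ w                 ≡⟨ cong (_+ σ w) (sumFin-remove σ′ w) ⟩
    σ′ w + sumFin (σ′ ∘ p) + σ w    ≤⟨ +-monoˡ-≤ (σ w) (+-mono-≤ (σ′≤1 w) (sumFin-mono σ′≤σ)) ⟩
    1 + sumFin (σ ∘ p) + σ w        ≡⟨ cong suc (+-comm (sumFin (σ ∘ p)) (σ w)) ⟩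
    1 + (σ w + sumFin (σ ∘ p))      ≡⟨ cong suc (sumFin-remove σ w) ⟨
    1 + sumFin σ                    ≡⟨ cong suc (sumFin-degS G S) ⟩
    1 + 2 * crossing G S            ∎
    where
    open ≤-Reasoning
    σ = degS G S
    σ′ = degS G S′
    p = punchIn w
    σ′≤σ : ∀ i → σ′ (p i) ≤ σ (p i)
    σ′≤σ i = m≤1⇒m≤2*n⇒m≤n (σ′≤1 (p i)) (degS≤2*degS G S stable S′ (p i))

  crossing-gap : ∀ S′ w → degS G S′ w + 2 ≤ 2 * degS G S w → crossing G S′ + 2 ≤ 2 * crossing G S
  crossing-gap S′ w gap = parity-gap {p = p} {q} {crossing G S} C′+2≤2p C′≤2q p+q≡2C
    where
    open ≤-Reasoning
    σ = degS G S
    σ′ = degS G S′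
    b = S′ w
    p = sumFin (λ a → onSide S′ b a * σ a)
    q = sumFin (λ a → onSide S′ (not b) a * σ a)
    scaled : ∀ c a → c * σ′ a ≤ 2 * (c * σ a)
    scaled c a = ≤-trans (*-monoʳ-≤ c (degS≤2*degS G S stable S′ a)) (≤-reflexive (x*[2*y]≡2*[x*y] c (σ a)))
      where
      x*[2*y]≡2*[x*y] : ∀ x y → x * (2 * y) ≡ 2 * (x * y)
      x*[2*y]≡2*[x*y] = solve-∀
    scaled-gap : onSide S′ b w * σ′ w + 2 ≤ 2 * (onSide S′ b w * σ w)
    scaled-gap = subst (λ c → c * σ′ w + 2 ≤ 2 * (c * σ w)) (sym (onSide-self S′ w))
      (subst₂ (λ x y → x + 2 ≤ 2 * y) (sym (*-identityˡ (σ′ w))) (sym (*-identityˡ (σ w))) gap)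
    C′+2≤2p : crossing G S′ + 2 ≤ 2 * p
    C′+2≤2p = begin
      crossing G S′ + 2                                 ≡⟨ cong (_+ 2) (sumFin-onSide-degS G S′ b) ⟨
      sumFin (λ a → onSide S′ b a * σ′ a) + 2           ≤⟨ sumFin-mono-gap w (λ a → scaled (onSide S′ b a) a) scaled-gap ⟩
      sumFin (λ a → 2 * (onSide S′ b a * σ a))          ≡⟨ sumFin-distribˡ-* 2 (λ a → onSide S′ b a * σ a) ⟩
      2 * p                                             ∎
    C′≤2q : crossing G S′ ≤ 2 * q
    C′≤2q = begin
      crossing G S′                                     ≡⟨ sumFin-onSide-degS G S′ (not b) ⟨
      sumFin (λ a → onSide S′ (not b) a * σ′ a)         ≤⟨ sumFin-mono (λ a → scaled (onSide S′ (not b) a) a) ⟩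
      sumFin (λ a → 2 * (onSide S′ (not b) a * σ a))    ≡⟨ sumFin-distribˡ-* 2 (λ a → onSide S′ (not b) a * σ a) ⟩
      2 * q                                             ∎
    p+q≡2C : p + q ≡ 2 * crossing G S
    p+q≡2C = trans (sumFin-onSide+onSide-not S′ b σ) (sumFin-degS G S)

  maxDegS≡1⇒φ≤φ : maxDegS G S ≤ 2 → ∀ S′ → maxDegS G S′ ≡ 1 → φ G S′ ≤ φ G S
  maxDegS≡1⇒φ≤φ M≤2 S′ M′≡1 = 2[m+1]+k≤1+2[n+k]⇒m≤n M≤2 (begin
    2 * (φ G S′ + 1) + M      ≡⟨ cong (λ c → 2 * c + M) (crossing≡φ+maxDegS G S′ M′≡1) ⟨
    2 * crossing G S′ + M     ≡⟨ cong (2 * crossing G S′ +_) M≡σw ⟩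
    2 * crossing G S′ + σ w   ≤⟨ 2*crossing+degS≤1+2*crossing S′ σ′≤1 w ⟩
    1 + 2 * crossing G S      ≡⟨ cong (λ c → 1 + 2 * c) (crossing≡φ+maxDegS G S refl) ⟩
    1 + 2 * (φ G S + M)       ∎)
    where
    open ≤-Reasoning
    σ = degS G S
    M = maxDegS G S
    w = proj₁ (maxFin-attained σ)
    M≡σw = proj₂ (maxFin-attained σ)
    σ′≤1 : ∀ v → degS G S′ v ≤ 1
    σ′≤1 v = subst (degS G S′ v ≤_) M′≡1 (≤-maxFin (degS G S′) v)

  2*maxDegS≤maxDegS⇒φ≤2*φ : ∀ S′ → 2 * maxDegS G S ≤ maxDegS G S′ → φ G S′ ≤ 2 * φ G S
  2*maxDegS≤maxDegS⇒φ≤2*φ S′ 2M≤M′ = +-cancelʳ-≤ (maxDegS G S′) (φ G S′) (2 * φ G S) (begin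
    φ G S′ + maxDegS G S′           ≡⟨ φ+maxDegS≡crossing G S′ ⟩
    crossing G S′                   ≤⟨ crossing≤2*crossing G S stable S′ ⟩
    2 * crossing G S                ≡⟨ cong (2 *_) (φ+maxDegS≡crossing G S) ⟨
    2 * (φ G S + maxDegS G S)       ≡⟨ *-distribˡ-+ 2 (φ G S) (maxDegS G S) ⟩
    2 * φ G S + 2 * maxDegS G S     ≤⟨ +-monoʳ-≤ (2 * φ G S) 2M≤M′ ⟩
    2 * φ G S + maxDegS G S′        ∎)
    where open ≤-Reasoning

  maxDegS≡2⇒φ≤2*φ : maxDegS G S ≡ 2 → ∀ S′ → maxDegS G S′ ≡ 2 → φ G S′ ≤ 2 * φ G S
  maxDegS≡2⇒φ≤2*φ M≡2 S′ M′≡2 = +-cancelʳ-≤ 4 (φ G S′) (2 * φ G S) (begin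
    φ G S′ + 4          ≡⟨ +-assoc (φ G S′) 2 2 ⟨
    φ G S′ + 2 + 2      ≡⟨ cong (_+ 2) (crossing≡φ+maxDegS G S′ M′≡2) ⟨
    crossing G S′ + 2   ≤⟨ crossing-gap S′ w gap ⟩
    2 * crossing G S    ≡⟨ cong (2 *_) (crossing≡φ+maxDegS G S M≡2) ⟩
    2 * (φ G S + 2)     ≡⟨ *-distribˡ-+ 2 (φ G S) 2 ⟩
    2 * φ G S + 4       ∎)
    where
    open ≤-Reasoning
    w = proj₁ (maxFin-attained (degS G S))
    σw≡2 : degS G S w ≡ 2
    σw≡2 = trans (sym (proj₂ (maxFin-attained (degS G S)))) M≡2
    gap : degS G S′ w + 2 ≤ 2 * degS G S w
    gap = subst (λ d → degS G S′ w + 2 ≤ 2 * d) (sym σw≡2)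
      (+-monoˡ-≤ 2 (subst (degS G S′ w ≤_) M′≡2 (≤-maxFin (degS G S′) w)))

lemma25 : (m : ℕ) (G : Graph (suc m)) → MaxDegreeAtMost G 2 →
          (S : Cut (suc m)) → Stable G S →
          (S′ : Cut (suc m)) → φ G S′ ≤ 2 * φ G S
lemma25 m G Δ≤2 S stable S′ with maxDegS G S′ in M′≡ | maxDegS G S in M≡
... | 0 | _ = ≤-trans (≤-reflexive (maxDegS≡0⇒φ≡0 G S′ M′≡)) z≤n
... | _ | 0 = 2*maxDegS≤maxDegS⇒φ≤2*φ G S stable S′ (subst (λ M → 2 * M ≤ maxDegS G S′) (sym M≡) z≤n)
... | 1 | _ = ≤-trans (maxDegS≡1⇒φ≤φ G S stable (maxDegS≤ G S Δ≤2) S′ M′≡) (m≤m+n (φ G S) _)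
... | 2 | 1 = 2*maxDegS≤maxDegS⇒φ≤2*φ G S stable S′ (≤-reflexive (trans (cong (2 *_) M≡) (sym M′≡)))
... | 2 | 2 = maxDegS≡2⇒φ≤2*φ G S stable M≡ S′ M′≡
... | 2 | suc (suc (suc _)) = contradiction (subst (_≤ 2) M≡ (maxDegS≤ G S Δ≤2)) λ { (s≤s (s≤s ())) }
... | suc (suc (suc _)) | _ = contradiction (subst (_≤ 2) M′≡ (maxDegS≤ G S′ Δ≤2)) λ { (s≤s (s≤s ())) }
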